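{- For every integer $n\ge 4$, $$\beta_b(\overrightarrow{C}(n;1,3)) = \beta_b(\overrightarrow{C}(n;1,-(n-3))) = \left\lfloor\frac{n}{2}\right\rfloor.$$
   Context: For integers $n\ge 3$ and $b_1,\dots,b_k$, the oriented circulant graph $\overrightarrow{C}(n;b_1,\dots,b_k)$ has vertex set $\{v_0,\dots,v_{n-1}\}$ and arc set $\{v_iv_{i+b_j} : 0\le i\le n-1,\ 1\le j\le k\}$, with subscripts taken modulo $n$ (negative $b_j$ allowed). $d(u,v)$ is the length of a shortest directed path from $u$ to $v$; $e(v)=\max_u d(v,u)$ is the eccentricity; $\mathrm{diam}$ is the maximum eccentricity. An independent broadcast on an oriented graph $\overrightarrow{G}$ is a function $f:V(\overrightarrow{G})\to\{0,\dots,\mathrm{diam}(\overrightarrow{G})\}$ with $f(v)\le e(v)$ for all $v$, and $d(u,v)>f(u)$ for all distinct $u,v$ with $f(u),f(v)>0$. Its cost is $\sigma(f)=\sum_v f(v)$, and $\beta_b(\overrightarrow{G})$ is the maximum cost of an independent broadcast on $\overrightarrow{G}$. -}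

module Defs where

open import Data.Nat using (ℕ; zero; suc; _≤_; _<_)
open import Data.Integer as ℤ using (ℤ; +_; _-_)
open import Data.Integer.Divisibility using (_∣_)
open import Data.Fin using (Fin; toℕ)
open import Data.List using (List; map; allFin)
open import Data.Nat.ListAction using (sum)
open import Data.List.Relation.Unary.Any using (Any)
open import Data.Product using (Σ; ∃; _×_)
open import Relation.Binary.PropositionalEquality using (_≡_; _≢_)
open import Relation.Nullary using (¬_)

record Digraph (n : ℕ) : Set₁ where
  field
    Arc : Fin n → Fin n → Set

open Digraph public

Circulant : (n : ℕ) → List ℤ → Digraph n
Circulant n bs = record
  { Arc = λ i j → Any (λ b → (+ n) ∣ ((+ toℕ j) - ((+ toℕ i) ℤ.+ b))) bs }

module _ {n : ℕ} (G : Digraph n) where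

  data Walk : ℕ → Fin n → Fin n → Set where
    here : ∀ {u} → Walk zero u u
    step : ∀ {k u w v} → Arc G u w → Walk k w v → Walk (suc k) u v

  IsDist : Fin n → Fin n → ℕ → Set
  IsDist u v m = Walk m u v × (∀ k → k < m → ¬ Walk k u v)

  IsEcc : Fin n → ℕ → Set
  IsEcc v m = (∀ u d → IsDist v u d → d ≤ m) × ∃ (λ u → IsDist v u m)

  IsDiam : ℕ → Set
  IsDiam D = (∀ v e → IsEcc v e → e ≤ D) × ∃ (λ v → IsEcc v D)

  IsIndepBroadcast : (Fin n → ℕ) → Set
  IsIndepBroadcast f =
      (∀ D → IsDiam D → ∀ v → f v ≤ D)
    × (∀ v e → IsEcc v e → f v ≤ e)
    × (∀ u v → u ≢ v → 0 < f u → 0 < f v → ∀ d → IsDist u v d → f u < d)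

  cost : (Fin n → ℕ) → ℕ
  cost f = sum (map f (allFin n))

  IsBroadcastIndepNumber : ℕ → Set
  IsBroadcastIndepNumber m =
      Σ (Fin n → ℕ) (λ f → IsIndepBroadcast f × cost f ≡ m)
    × (∀ f → IsIndepBroadcast f → cost f ≤ m)

{-# OPTIONS --safe #-}
-- Both graphs have exactly the arcs v → v + 1 and v → v + 3 (mod n), as −(n − 3) ≡ 3.
-- An offset j is reached by about j/2 jumps (threes, then ones), so eccentricities are at
-- most n/2, and a vertex u broadcasting f(u) > 0 forces f = 0 on u + 1, …, u + 2f(u) − 1.
-- The windows [u, u + 2f(u)) are thus disjoint arcs of the n-cycle, whence 2σ(f) ≤ n.
-- Conversely, for even n put 1 on the odd vertices (every arc changes parity); for odd n
-- put 2 on v₀ and 1 on the odd vertices v₅, v₇, …, v_{n−2}.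
module Submission where

open import Defs
open import Data.Nat.Base
  using (ℕ; zero; suc; _+_; _*_; _∸_; _/_; _%_; _≤_; _<_; z≤n; s≤s; s≤s⁻¹; z<s; NonZero; >-nonZero)
open import Data.Nat.Properties
open import Data.Nat.DivMod
  using ( _mod_; m≡m%n+[m/n]*n; m%n<n; m<n⇒m%n≡m; m%n%n≡m%n; [m+n]%n≡m%n; [m+kn]%n≡m%n
        ; %-distribˡ-+; %-remove-+ʳ; m∣n⇒o%n%m≡o%m; m*n/n≡m; /-monoˡ-≤)
open import Data.Nat.Divisibility using (divides; ∣⇒≤) renaming (_∣_ to _∣ℕ_)
open import Data.Nat.Induction using (<-wellFounded)
open import Data.Nat.ListAction using (sum)
open import Data.Integer as ℤ using (+_; -_; _-_; _⊖_; ∣_∣)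
open import Data.Integer.Properties using (m-n≡m⊖n; ∣m⊖n∣≡∣n⊖m∣; ∣⊖∣-≤; neg-involutive)
open import Data.Integer.Divisibility using (_∣_)
open import Data.Integer.Divisibility.Signed
  using (∣ᵤ⇒∣; ∣⇒∣ᵤ; ∣m∣n⇒∣m+n; ∣m+n∣n⇒∣m) renaming (_∣_ to _∣ˢ_)
open import Data.Integer.Tactic.RingSolver using (solve-∀)
open import Data.Fin as Fin using (Fin; toℕ)
open import Data.Fin.Properties
  using (toℕ<n; toℕ-fromℕ<; toℕ-injective; any?) renaming (_≟_ to _≟ᶠ_)
open import Data.List using (_∷_; []; allFin; applyUpTo; tabulate)
open import Data.List.Properties using (map-tabulate)
open import Data.List.Relation.Unary.All as All using ()
open import Data.List.Relation.Unary.Any using (here; there)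
open import Data.List.Membership.Propositional.Properties using (∈-allFin)
open import Data.List.Extrema ≤-totalOrder using (argmax; f[xs]≤f[argmax])
open import Data.Product using (Σ; ∃; ∃-syntax; _×_; _,_; proj₁; proj₂)
open import Data.Sum using (inj₁; inj₂)
open import Data.Empty using (⊥-elim)
open import Function using (id; _∘_)
open import Function.Bundles using (_⇔_; mk⇔; Equivalence)
open import Function.Properties.Equivalence using () renaming (sym to ⇔-sym; trans to ⇔-trans)
open import Induction.WellFounded using (Acc; acc)
open import Relation.Nullary using (Dec; yes; no; ¬_)
open import Relation.Nullary.Decidable using (map′; from-yes; _×-dec_)
open import Relation.Binary.PropositionalEquality
  using (_≡_; _≢_; refl; sym; trans; cong; cong₂; subst; module ≡-Reasoning)

∑ : ℕ → (ℕ → ℕ) → ℕ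
∑ N g = sum (applyUpTo g N)

infix 5 ∑
syntax ∑ N (λ x → e) = ∑[ x < N ] e

∑-cong : ∀ N {g h : ℕ → ℕ} → (∀ x → g x ≡ h x) → ∑[ x < N ] g x ≡ ∑[ x < N ] h x
∑-cong zero    g≗h = refl
∑-cong (suc N) g≗h = cong₂ _+_ (g≗h 0) (∑-cong N (λ x → g≗h (suc x)))

∑-zero : ∀ N {g : ℕ → ℕ} → (∀ x → x < N → g x ≡ 0) → ∑[ x < N ] g x ≡ 0
∑-zero zero    g≡0 = refl
∑-zero (suc N) g≡0 = cong₂ _+_ (g≡0 0 z<s) (∑-zero N (λ x x<N → g≡0 (suc x) (s≤s x<N)))

∑-split : ∀ k M (g : ℕ → ℕ) → ∑[ x < k + M ] g x ≡ (∑[ x < k ] g x) + (∑[ x < M ] g (k + x))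
∑-split zero    M g = refl
∑-split (suc k) M g =
  trans (cong (_+_ (g 0)) (∑-split k M (λ x → g (suc x)))) (sym (+-assoc (g 0) _ _))

∑-*ʳ : ∀ N (g : ℕ → ℕ) c → ∑[ x < N ] g x * c ≡ (∑[ x < N ] g x) * c
∑-*ʳ zero    g c = refl
∑-*ʳ (suc N) g c =
  trans (cong (_+_ (g 0 * c)) (∑-*ʳ N (λ x → g (suc x)) c)) (sym (*-distribʳ-+ c (g 0) _))

∑-rotate : ∀ {n} (F : ℕ → ℕ) s → (∀ x → F (n + x) ≡ F x) → s ≤ n →
           ∑[ x < n ] F (s + x) ≡ ∑[ x < n ] F x
∑-rotate F s periodic s≤n with m≤n⇒∃[o]m+o≡n s≤n
... | t , refl = begin
  ∑[ x < s + t ] F (s + x)                              ≡⟨ cong (λ m → ∑[ x < m ] F (s + x)) (+-comm s t) ⟩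
  ∑[ x < t + s ] F (s + x)                              ≡⟨ ∑-split t s (λ x → F (s + x)) ⟩
  (∑[ x < t ] F (s + x)) + (∑[ x < s ] F (s + (t + x))) ≡⟨ cong (_+_ (∑[ x < t ] F (s + x))) (∑-cong s wrap) ⟩
  (∑[ x < t ] F (s + x)) + (∑[ x < s ] F x)             ≡⟨ +-comm (∑[ x < t ] F (s + x)) (∑[ x < s ] F x) ⟩
  (∑[ x < s ] F x) + (∑[ x < t ] F (s + x))             ≡⟨ ∑-split s t F ⟨
  ∑[ x < s + t ] F x                                    ∎
  where
  open ≡-Reasoning
  wrap : ∀ x → F (s + (t + x)) ≡ F x
  wrap x = trans (cong F (sym (+-assoc s t x))) (periodic x)

sum-tabulate : ∀ {N} (f : Fin N → ℕ) (g : ℕ → ℕ) → (∀ i → f i ≡ g (toℕ i)) →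
               sum (tabulate f) ≡ ∑[ x < N ] g x
sum-tabulate {zero}  f g f≗g = refl
sum-tabulate {suc N} f g f≗g =
  cong₂ _+_ (f≗g Fin.zero) (sum-tabulate (f ∘ Fin.suc) (g ∘ suc) (f≗g ∘ Fin.suc))

-- Both sums compute: (2 + x) % 2 reduces to x % 2.
∑-parity : ∀ m → ∑[ x < m * 2 ] x % 2 ≡ m
∑-parity zero    = refl
∑-parity (suc m) = cong suc (∑-parity m)

∑-parity-suc : ∀ m → ∑[ x < m * 2 ] suc x % 2 ≡ m
∑-parity-suc zero    = refl
∑-parity-suc (suc m) = cong suc (∑-parity-suc m)

Packed : ℕ → (ℕ → ℕ) → Set
Packed N ℓ = ∀ x → x < N → x + ℓ x ≤ N × (∀ j → 0 < j → j < ℓ x → ℓ (x + j) ≡ 0)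

Packed-shift : ∀ k {M ℓ} → Packed (k + M) ℓ → Packed M (λ x → ℓ (k + x))
Packed-shift k {M} {ℓ} packed x x<M with packed (k + x) (+-monoʳ-< k x<M)
... | fits , gap = +-cancelˡ-≤ k _ _ (subst (_≤ k + M) (+-assoc k x (ℓ (k + x))) fits)
                 , λ j 0<j j<ℓ → trans (cong ℓ (sym (+-assoc k x j))) (gap j 0<j j<ℓ)

∑-block : ∀ L (ℓ : ℕ → ℕ) → 0 < L → (∀ j → 0 < j → j < L → ℓ j ≡ 0) →
          ∑[ x < L ] ℓ x ≡ ℓ 0
∑-block (suc c) ℓ _ gap =
  trans (cong (_+_ (ℓ 0)) (∑-zero c (λ x x<c → gap (suc x) z<s (s≤s x<c)))) (+-identityʳ (ℓ 0))

∑≤-Packed : ∀ N {ℓ} → Packed N ℓ → ∑[ x < N ] ℓ x ≤ N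
∑≤-Packed N = go (<-wellFounded N)
  where
  go : ∀ {N ℓ} → Acc _<_ N → Packed N ℓ → ∑[ x < N ] ℓ x ≤ N
  go {zero}      _         _      = z≤n
  go {suc N} {ℓ} (acc rec) packed with ℓ 0 ≟ 0
  ... | yes ℓ0≡0 = begin
    ℓ 0 + (∑[ x < N ] ℓ (suc x)) ≡⟨ cong (_+ (∑[ x < N ] ℓ (suc x))) ℓ0≡0 ⟩
    ∑[ x < N ] ℓ (suc x)         ≤⟨ go (rec ≤-refl) (Packed-shift 1 packed) ⟩
    N                            <⟨ n<1+n N ⟩
    suc N                        ∎
    where open ≤-Reasoning
  ... | no ℓ0≢0 = begin
    ∑[ x < suc N ] ℓ x                            ≡⟨ cong (λ m → ∑[ x < m ] ℓ x) L+M≡1+N ⟨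
    ∑[ x < ℓ 0 + M ] ℓ x                          ≡⟨ ∑-split (ℓ 0) M ℓ ⟩
    (∑[ x < ℓ 0 ] ℓ x) + (∑[ x < M ] ℓ (ℓ 0 + x)) ≡⟨ cong (_+ (∑[ x < M ] ℓ (ℓ 0 + x))) first-block ⟩
    ℓ 0 + (∑[ x < M ] ℓ (ℓ 0 + x))                ≤⟨ +-monoʳ-≤ (ℓ 0) rest ⟩
    ℓ 0 + M                                       ≡⟨ L+M≡1+N ⟩
    suc N                                         ∎
    where
    open ≤-Reasoning
    M : ℕ
    M = suc N ∸ ℓ 0
    L+M≡1+N : ℓ 0 + M ≡ suc N
    L+M≡1+N = m+[n∸m]≡n (proj₁ (packed 0 z<s))
    first-block : ∑[ x < ℓ 0 ] ℓ x ≡ ℓ 0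
    first-block = ∑-block (ℓ 0) ℓ (n≢0⇒n>0 ℓ0≢0) (proj₂ (packed 0 z<s))
    M<1+N : M < suc N
    M<1+N = subst (M <_) L+M≡1+N (m<n+m M (n≢0⇒n>0 ℓ0≢0))
    rest : ∑[ x < M ] ℓ (ℓ 0 + x) ≤ M
    rest = go (rec M<1+N) (Packed-shift (ℓ 0) (subst (λ m → Packed m ℓ) (sym L+M≡1+N) packed))

maximum-attained : ∀ {n} (g : Fin n → ℕ) → Fin n → ∃[ i ] (∀ k → g k ≤ g i)
maximum-attained {n} g i₀ =
  argmax g i₀ (allFin n) , λ k → All.lookup (f[xs]≤f[argmax] i₀ (allFin n)) (∈-allFin k)

cost≡∑ : ∀ {n} (G : Digraph n) (f : Fin n → ℕ) (g : ℕ → ℕ) → (∀ i → f i ≡ g (toℕ i)) →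
         cost G f ≡ ∑[ x < n ] g x
cost≡∑ G f g f≗g = trans (cong sum (map-tabulate id f)) (sum-tabulate f g f≗g)

module _ {n : ℕ} (G : Digraph n) where

  IsDist⇒≤ : ∀ {u v d k} → IsDist G u v d → Walk G k u v → d ≤ k
  IsDist⇒≤ (_ , shortest) w = ≮⇒≥ (λ k<d → shortest _ k<d w)

  IsDist-unique : ∀ {u v d d′} → IsDist G u v d → IsDist G u v d′ → d ≡ d′
  IsDist-unique p q = ≤-antisym (IsDist⇒≤ p (proj₁ q)) (IsDist⇒≤ q (proj₁ p))

  module _ (arc? : ∀ u v → Dec (Arc G u v)) where

    walk? : ∀ k u v → Dec (Walk G k u v)
    walk? zero    u v = map′ (λ { refl → here }) (λ { here → refl }) (u ≟ᶠ v)
    walk? (suc k) u v = map′ (λ (w , a , p) → step a p) (λ { (step a p) → _ , a , p })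
                             (any? λ w → arc? u w ×-dec walk? k w v)

    IsDist-exists : ∀ {k u v} → Walk G k u v → ∃ (IsDist G u v)
    IsDist-exists {k} {u} {v} = shortest (<-wellFounded k)
      where
      shortest : ∀ {k} → Acc _<_ k → Walk G k u v → ∃ (IsDist G u v)
      shortest {k} (acc rec) w with anyUpTo? (λ j → walk? j u v) k
      ... | yes (j , j<k , w′) = shortest (rec j<k) w′
      ... | no none            = k , w , λ j j<k w′ → none (j , j<k , w′)

    IsEcc-exists : ∀ u → (∀ v → ∃[ k ] Walk G k u v) → ∃ (IsEcc G u)
    IsEcc-exists u reach = dist far , bounded , far , isDist far
      where
      dist : Fin n → ℕ
      dist v = proj₁ (IsDist-exists (proj₂ (reach v)))
      isDist : ∀ v → IsDist G u v (dist v)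
      isDist v = proj₂ (IsDist-exists (proj₂ (reach v)))
      far : Fin n
      far = proj₁ (maximum-attained dist u)
      bounded : ∀ v d → IsDist G u v d → d ≤ dist far
      bounded v d p =
        subst (_≤ dist far) (IsDist-unique (isDist v) p) (proj₂ (maximum-attained dist u) v)

module _ {n : ℕ} .{{_ : NonZero n}} where

  m%n≡o%n⇔n∣m∸o : ∀ {m o} → o ≤ m → m % n ≡ o % n ⇔ n ∣ℕ m ∸ o
  m%n≡o%n⇔n∣m∸o {m} {o} o≤m = mk⇔ to from
    where
    open ≡-Reasoning
    to : m % n ≡ o % n → n ∣ℕ m ∸ o
    to eq = divides (m / n ∸ o / n) (begin
      m ∸ o                                     ≡⟨ cong₂ _∸_ (m≡m%n+[m/n]*n m n) (m≡m%n+[m/n]*n o n) ⟩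
      (m % n + m / n * n) ∸ (o % n + o / n * n) ≡⟨ cong (λ r → (r + m / n * n) ∸ (o % n + o / n * n)) eq ⟩
      (o % n + m / n * n) ∸ (o % n + o / n * n) ≡⟨ [m+n]∸[m+o]≡n∸o (o % n) (m / n * n) (o / n * n) ⟩
      m / n * n ∸ o / n * n                     ≡⟨ *-distribʳ-∸ n (m / n) (o / n) ⟨
      (m / n ∸ o / n) * n                       ∎)
    from : n ∣ℕ m ∸ o → m % n ≡ o % n
    from n∣m∸o = trans (cong (_% n) (sym (m+[n∸m]≡n o≤m))) (%-remove-+ʳ o n∣m∸o)

  m%n≡o%n⇔n∣∣m⊖o∣ : ∀ m o → m % n ≡ o % n ⇔ n ∣ℕ ∣ m ⊖ o ∣
  m%n≡o%n⇔n∣∣m⊖o∣ m o with ≤-total o m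
  ... | inj₁ o≤m = subst (λ k → m % n ≡ o % n ⇔ n ∣ℕ k) (sym ∣m⊖o∣≡m∸o) (m%n≡o%n⇔n∣m∸o o≤m)
    where
    ∣m⊖o∣≡m∸o : ∣ m ⊖ o ∣ ≡ m ∸ o
    ∣m⊖o∣≡m∸o = trans (∣m⊖n∣≡∣n⊖m∣ m o) (∣⊖∣-≤ o≤m)
  ... | inj₂ m≤o = subst (λ k → m % n ≡ o % n ⇔ n ∣ℕ k) (sym (∣⊖∣-≤ m≤o))
                         (⇔-trans (mk⇔ sym sym) (m%n≡o%n⇔n∣m∸o m≤o))

  [m%n+o]%n≡[m+o]%n : ∀ m o → (m % n + o) % n ≡ (m + o) % n
  [m%n+o]%n≡[m+o]%n m o = begin
    (m % n + o) % n         ≡⟨ %-distribˡ-+ (m % n) o n ⟩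
    (m % n % n + o % n) % n ≡⟨ cong (λ r → (r + o % n) % n) (m%n%n≡m%n m n) ⟩
    (m % n + o % n) % n     ≡⟨ %-distribˡ-+ m o n ⟨
    (m + o) % n             ∎
    where open ≡-Reasoning

  [m+o%n]%n≡[m+o]%n : ∀ m o → (m + o % n) % n ≡ (m + o) % n
  [m+o%n]%n≡[m+o]%n m o = begin
    (m + o % n) % n         ≡⟨ %-distribˡ-+ m (o % n) n ⟩
    (m % n + o % n % n) % n ≡⟨ cong (λ r → (m % n + r) % n) (m%n%n≡m%n o n) ⟩
    (m % n + o % n) % n     ≡⟨ %-distribˡ-+ m o n ⟨
    (m + o) % n             ∎
    where open ≡-Reasoning

  toℕ%n : ∀ (v : Fin n) → toℕ v % n ≡ toℕ v
  toℕ%n v = m<n⇒m%n≡m (toℕ<n v)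

  toℕ-mod : ∀ m → toℕ (m mod n) ≡ m % n
  toℕ-mod m = toℕ-fromℕ< (m%n<n m n)

  mod-cong : ∀ {m o} → m % n ≡ o % n → m mod n ≡ o mod n
  mod-cong {m} {o} eq = toℕ-injective (trans (toℕ-mod m) (trans eq (sym (toℕ-mod o))))

  mod-toℕ : ∀ v → toℕ v mod n ≡ v
  mod-toℕ v = toℕ-injective (trans (toℕ-mod (toℕ v)) (toℕ%n v))

  infixl 6 _⊕_
  _⊕_ : Fin n → ℕ → Fin n
  u ⊕ j = (toℕ u + j) mod n

  ⊕-unique : ∀ {v} u j → toℕ v ≡ (toℕ u + j) % n → v ≡ u ⊕ j
  ⊕-unique u j eq = toℕ-injective (trans eq (sym (toℕ-mod (toℕ u + j))))

  ⊕-identityʳ : ∀ u → u ⊕ 0 ≡ u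
  ⊕-identityʳ u = sym (⊕-unique u 0 (sym (trans (cong (_% n) (+-identityʳ (toℕ u))) (toℕ%n u))))

  ⊕-assoc : ∀ u i j → u ⊕ i ⊕ j ≡ u ⊕ (i + j)
  ⊕-assoc u i j = ⊕-unique u (i + j) (begin
    toℕ (u ⊕ i ⊕ j)           ≡⟨ toℕ-mod (toℕ (u ⊕ i) + j) ⟩
    (toℕ (u ⊕ i) + j) % n     ≡⟨ cong (λ r → (r + j) % n) (toℕ-mod (toℕ u + i)) ⟩
    ((toℕ u + i) % n + j) % n ≡⟨ [m%n+o]%n≡[m+o]%n (toℕ u + i) j ⟩
    (toℕ u + i + j) % n       ≡⟨ cong (_% n) (+-assoc (toℕ u) i j) ⟩
    (toℕ u + (i + j)) % n     ∎)
    where open ≡-Reasoning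

  ⊕-period : ∀ u → u ⊕ n ≡ u
  ⊕-period u = sym (⊕-unique u n (sym (trans ([m+n]%n≡m%n (toℕ u) n) (toℕ%n u))))

  ⊕-≢ : ∀ u {j} → 0 < j → j < n → u ⊕ j ≢ u
  ⊕-≢ u {j} 0<j j<n u⊕j≡u =
    <⇒≱ j<n (∣⇒≤ {{>-nonZero 0<j}} (subst (n ∣ℕ_) (m+n∸m≡n (toℕ u) j) n∣[u+j]∸u))
    where
    n∣[u+j]∸u : n ∣ℕ toℕ u + j ∸ toℕ u
    n∣[u+j]∸u = Equivalence.to (m%n≡o%n⇔n∣m∸o (m≤m+n (toℕ u) j))
                  (trans (sym (toℕ-mod (toℕ u + j))) (trans (cong toℕ u⊕j≡u) (sym (toℕ%n u))))

  ⊕-surjective : ∀ u v → ∃[ j ] j < n × u ⊕ j ≡ v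
  ⊕-surjective u v = j , m%n<n _ n , sym (⊕-unique u j (sym (begin
    (toℕ u + j) % n                   ≡⟨ [m+o%n]%n≡[m+o]%n (toℕ u) (n ∸ toℕ u + toℕ v) ⟩
    (toℕ u + (n ∸ toℕ u + toℕ v)) % n ≡⟨ cong (_% n) (+-assoc (toℕ u) (n ∸ toℕ u) (toℕ v)) ⟨
    (toℕ u + (n ∸ toℕ u) + toℕ v) % n ≡⟨ cong (λ r → (r + toℕ v) % n) (m+[n∸m]≡n (<⇒≤ (toℕ<n u))) ⟩
    (n + toℕ v) % n                   ≡⟨ cong (_% n) (+-comm n (toℕ v)) ⟩
    (toℕ v + n) % n                   ≡⟨ [m+n]%n≡m%n (toℕ v) n ⟩
    toℕ v % n                         ≡⟨ toℕ%n v ⟩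
    toℕ v                             ∎)))
    where
    open ≡-Reasoning
    j : ℕ
    j = (n ∸ toℕ u + toℕ v) % n

data Jump : ℕ → Set where
  jump₁ : Jump 1
  jump₃ : Jump 3

infixr 5 _∷_
data Jumps : ℕ → ℕ → Set where
  []  : Jumps 0 0
  _∷_ : ∀ {c k j} → Jump c → Jumps k j → Jumps (suc k) (c + j)

Jumps-1-odd : ∀ {j} → Jumps 1 j → j % 2 ≡ 1
Jumps-1-odd (jump₁ ∷ []) = refl
Jumps-1-odd (jump₃ ∷ []) = refl

Jumps-1-≤3 : ∀ {j} → Jumps 1 j → j ≤ 3
Jumps-1-≤3 (jump₁ ∷ []) = s≤s z≤n
Jumps-1-≤3 (jump₃ ∷ []) = ≤-refl

hops : ℕ → ℕ
hops 0 = 0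
hops 1 = 1
hops 2 = 2
hops (suc (suc (suc j))) = suc (hops j)

hops-Jumps : ∀ j → Jumps (hops j) j
hops-Jumps 0 = []
hops-Jumps 1 = jump₁ ∷ []
hops-Jumps 2 = jump₁ ∷ jump₁ ∷ []
hops-Jumps (suc (suc (suc j))) = jump₃ ∷ hops-Jumps j

hops*2≤2+j : ∀ j → hops j * 2 ≤ 2 + j
hops*2≤2+j 0 = z≤n
hops*2≤2+j 1 = s≤s (s≤s z≤n)
hops*2≤2+j 2 = ≤-refl
hops*2≤2+j (suc (suc (suc j))) = s≤s (s≤s (m≤n⇒m≤1+n (hops*2≤2+j j)))

hops*2≤1+j : ∀ j → j ≢ 2 → hops j * 2 ≤ suc j
hops*2≤1+j 0 _ = z≤n
hops*2≤1+j 1 _ = ≤-refl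
hops*2≤1+j 2 2≢2 = ⊥-elim (2≢2 refl)
hops*2≤1+j (suc (suc (suc j))) _ = s≤s (s≤s (hops*2≤2+j j))

hops≤half : ∀ {j c} → j < c * 2 → hops j ≤ c
hops≤half {j} {c} j<2c with j ≟ 2
... | yes refl = *-cancelʳ-< 2 1 c j<2c
... | no j≢2   = *-cancelʳ-≤ (hops j) c 2 (≤-trans (hops*2≤1+j j j≢2) j<2c)

hops*2≤m : ∀ {j m} → 4 ≤ m → j < m → hops j * 2 ≤ m
hops*2≤m {j} 4≤m j<m with j ≟ 2
... | yes refl = 4≤m
... | no j≢2   = ≤-trans (hops*2≤1+j j j≢2) j<m

module _ {n : ℕ} .{{_ : NonZero n}} where

  Step : Fin n → Fin n → Set
  Step u v = ∃[ c ] Jump c × v ≡ u ⊕ c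

  ∣-jump⇔⊕ : ∀ (u v : Fin n) c → (+ n ∣ + toℕ v - (+ toℕ u ℤ.+ + c)) ⇔ v ≡ u ⊕ c
  ∣-jump⇔⊕ u v c = mk⇔ to from
    where
    s : ℕ
    s = toℕ u + c
    n∣⇔%≡ : (+ n ∣ + toℕ v - + s) ⇔ toℕ v % n ≡ s % n
    n∣⇔%≡ = subst (λ z → n ∣ℕ ∣ z ∣ ⇔ toℕ v % n ≡ s % n) (sym (m-n≡m⊖n (toℕ v) s))
                  (⇔-sym (m%n≡o%n⇔n∣∣m⊖o∣ (toℕ v) s))
    to : + n ∣ + toℕ v - + s → v ≡ u ⊕ c
    to n∣ = ⊕-unique u c (trans (sym (toℕ%n v)) (Equivalence.to n∣⇔%≡ n∣))
    from : v ≡ u ⊕ c → + n ∣ + toℕ v - + s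
    from refl = Equivalence.from n∣⇔%≡ (trans (cong (_% n) (toℕ-mod s)) (m%n%n≡m%n s n))

  ∣-jump-cong : ∀ x y b b′ → + n ∣ b′ - b → (+ n ∣ x - (y ℤ.+ b)) ⇔ (+ n ∣ x - (y ℤ.+ b′))
  ∣-jump-cong x y b b′ n∣b′-b = mk⇔ to from
    where
    shift : ∀ x y b b′ → x - (y ℤ.+ b) ≡ (x - (y ℤ.+ b′)) ℤ.+ (b′ - b)
    shift = solve-∀
    n∣ˢb′-b : + n ∣ˢ b′ - b
    n∣ˢb′-b = ∣ᵤ⇒∣ n∣b′-b
    to : + n ∣ x - (y ℤ.+ b) → + n ∣ x - (y ℤ.+ b′)
    to n∣ = ∣⇒∣ᵤ {i = x - (y ℤ.+ b′)}
              (∣m+n∣n⇒∣m (subst (+ n ∣ˢ_) (shift x y b b′) (∣ᵤ⇒∣ n∣)) n∣ˢb′-b)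
    from : + n ∣ x - (y ℤ.+ b′) → + n ∣ x - (y ℤ.+ b)
    from n∣ = ∣⇒∣ᵤ (subst (+ n ∣ˢ_) (sym (shift x y b b′))
                            (∣m∣n⇒∣m+n (∣ᵤ⇒∣ {i = x - (y ℤ.+ b′)} n∣) n∣ˢb′-b))

  circulant-arc⇔Step : ∀ {b} → (∀ {u v : Fin n} → (+ n ∣ + toℕ v - (+ toℕ u ℤ.+ b)) ⇔ v ≡ u ⊕ 3) →
                       ∀ {u v} → Arc (Circulant n (+ 1 ∷ b ∷ [])) u v ⇔ Step u v
  circulant-arc⇔Step {b} b-jump⇔⊕3 {u} {v} = mk⇔ to from
    where
    to : Arc (Circulant n (+ 1 ∷ b ∷ [])) u v → Step u v
    to (here n∣)         = 1 , jump₁ , Equivalence.to (∣-jump⇔⊕ u v 1) n∣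
    to (there (here n∣)) = 3 , jump₃ , Equivalence.to b-jump⇔⊕3 n∣
    from : Step u v → Arc (Circulant n (+ 1 ∷ b ∷ [])) u v
    from (_ , jump₁ , v≡u⊕1) = here (Equivalence.from (∣-jump⇔⊕ u v 1) v≡u⊕1)
    from (_ , jump₃ , v≡u⊕3) = there (here (Equivalence.from b-jump⇔⊕3 v≡u⊕3))

  C[1,3]-arc⇔Step : ∀ {u v} → Arc (Circulant n (+ 1 ∷ + 3 ∷ [])) u v ⇔ Step u v
  C[1,3]-arc⇔Step = circulant-arc⇔Step (λ {u} {v} → ∣-jump⇔⊕ u v 3)

  C[1,3-n]-arc⇔Step : 3 ≤ n →
                      ∀ {u v} → Arc (Circulant n (+ 1 ∷ - (+ (n ∸ 3)) ∷ [])) u v ⇔ Step u v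
  C[1,3-n]-arc⇔Step 3≤n = circulant-arc⇔Step λ {u} {v} →
    ⇔-trans (∣-jump-cong (+ toℕ v) (+ toℕ u) (- (+ (n ∸ 3))) (+ 3) n∣3+[n∸3]) (∣-jump⇔⊕ u v 3)
    where
    n∣3+[n∸3] : + n ∣ + 3 - - (+ (n ∸ 3))
    n∣3+[n∸3] = subst (λ z → n ∣ℕ ∣ + 3 ℤ.+ z ∣) (sym (neg-involutive (+ (n ∸ 3))))
                  (subst (n ∣ℕ_) (sym (m+[n∸m]≡n 3≤n)) (divides 1 (sym (*-identityˡ n))))

*2≤⇒≤/2 : ∀ {c m} → c * 2 ≤ m → c ≤ m / 2
*2≤⇒≤/2 {c} {m} c*2≤m = subst (_≤ m / 2) (m*n/n≡m c 2) (/-monoˡ-≤ 2 c*2≤m)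

odd+odd : ∀ a b → a % 2 ≡ 1 → b % 2 ≡ 1 → (a + b) % 2 ≡ 0
odd+odd a b a-odd b-odd = trans (%-distribˡ-+ a b 2) (cong₂ (λ x y → (x + y) % 2) a-odd b-odd)

spike-odd : ℕ → ℕ
spike-odd 0 = 2
spike-odd 1 = 0
spike-odd 2 = 0
spike-odd 3 = 0
spike-odd 4 = 0
spike-odd x@(suc (suc (suc (suc (suc _))))) = x % 2

spike-odd≤2 : ∀ x → spike-odd x ≤ 2
spike-odd≤2 0 = ≤-refl
spike-odd≤2 1 = z≤n
spike-odd≤2 2 = z≤n
spike-odd≤2 3 = z≤n
spike-odd≤2 4 = z≤n
spike-odd≤2 x@(suc (suc (suc (suc (suc _))))) = m≤n⇒m≤1+n (s≤s⁻¹ (m%n<n x 2))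

∑-spike-odd : ∀ m → 4 ≤ suc (m * 2) → ∑[ x < suc (m * 2) ] spike-odd x ≡ m
∑-spike-odd (suc (suc m)) _ = cong (_+_ 2) (∑-parity-suc m)
∑-spike-odd 0 (s≤s ())
∑-spike-odd 1 (s≤s (s≤s (s≤s ())))

module OneThreeCirculant {n : ℕ} .{{_ : NonZero n}} (4≤n : 4 ≤ n)
                         (G : Digraph n) (arc⇔Step : ∀ {u v} → Arc G u v ⇔ Step u v) where

  step? : ∀ u v → Dec (Step u v)
  step? u v with v ≟ᶠ u ⊕ 1 | v ≟ᶠ u ⊕ 3
  ... | yes v≡u⊕1 | _         = yes (1 , jump₁ , v≡u⊕1)
  ... | no _      | yes v≡u⊕3 = yes (3 , jump₃ , v≡u⊕3)
  ... | no v≢u⊕1  | no v≢u⊕3  = no λ { (_ , jump₁ , v≡u⊕1) → v≢u⊕1 v≡u⊕1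
                                       ; (_ , jump₃ , v≡u⊕3) → v≢u⊕3 v≡u⊕3 }

  arc? : ∀ u v → Dec (Arc G u v)
  arc? u v = map′ (Equivalence.from arc⇔Step) (Equivalence.to arc⇔Step) (step? u v)

  walk→Jumps : ∀ {k u v} → Walk G k u v → ∃[ j ] Jumps k j × v ≡ u ⊕ j
  walk→Jumps {u = u} here = 0 , [] , sym (⊕-identityʳ u)
  walk→Jumps {u = u} (step arc w) with Equivalence.to arc⇔Step arc | walk→Jumps w
  ... | c , jump , refl | j , jumps , refl = c + j , jump ∷ jumps , ⊕-assoc u c j

  Jumps→walk : ∀ {k j} u → Jumps k j → Walk G k u (u ⊕ j)
  Jumps→walk u [] = subst (Walk G 0 u) (sym (⊕-identityʳ u)) here
  Jumps→walk u (_∷_ {c} {k} {j} jump jumps) =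
    step (Equivalence.from arc⇔Step (c , jump , refl))
         (subst (Walk G k (u ⊕ c)) (⊕-assoc u c j) (Jumps→walk (u ⊕ c) jumps))

  dist*2≤n : ∀ {u v d} → IsDist G u v d → d * 2 ≤ n
  dist*2≤n {u} {v} isDist with ⊕-surjective u v
  ... | j , j<n , refl =
    ≤-trans (*-monoˡ-≤ 2 (IsDist⇒≤ G isDist (Jumps→walk u (hops-Jumps j)))) (hops*2≤m 4≤n j<n)

  ecc-exists : ∀ u → ∃ (IsEcc G u)
  ecc-exists u = IsEcc-exists G arc? u reach
    where
    reach : ∀ v → ∃[ k ] Walk G k u v
    reach v with ⊕-surjective u v
    ... | j , _ , refl = hops j , Jumps→walk u (hops-Jumps j)

  module _ {f : Fin n → ℕ} (indep : IsIndepBroadcast G f) where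

    f≤ecc : ∀ v e → IsEcc G v e → f v ≤ e
    f≤ecc = proj₁ (proj₂ indep)

    f<dist : ∀ u v → u ≢ v → 0 < f u → 0 < f v → ∀ d → IsDist G u v d → f u < d
    f<dist = proj₂ (proj₂ indep)

    broadcast*2≤n : ∀ u → f u * 2 ≤ n
    broadcast*2≤n u = ≤-trans (*-monoˡ-≤ 2 (f≤ecc u e ecc)) (dist*2≤n (proj₂ (proj₂ ecc)))
      where
      e : ℕ
      e = proj₁ (ecc-exists u)
      ecc : IsEcc G u e
      ecc = proj₂ (ecc-exists u)

    broadcast-gap : ∀ u {j} → 0 < j → j < f u * 2 → f (u ⊕ j) ≡ 0
    broadcast-gap u {j} 0<j j<2fu = n≤0⇒n≡0 (≮⇒≥ λ 0<fv → <⇒≱ (fu<d 0<fv) d≤fu)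
      where
      walk : Walk G (hops j) u (u ⊕ j)
      walk = Jumps→walk u (hops-Jumps j)
      d : ℕ
      d = proj₁ (IsDist-exists G arc? walk)
      isDist : IsDist G u (u ⊕ j) d
      isDist = proj₂ (IsDist-exists G arc? walk)
      d≤fu : d ≤ f u
      d≤fu = ≤-trans (IsDist⇒≤ G isDist walk) (hops≤half j<2fu)
      u≢u⊕j : u ≢ u ⊕ j
      u≢u⊕j u≡u⊕j = ⊕-≢ u 0<j (<-≤-trans j<2fu (broadcast*2≤n u)) (sym u≡u⊕j)
      fu<d : 0 < f (u ⊕ j) → f u < d
      fu<d 0<fv = f<dist u (u ⊕ j) u≢u⊕j (*-cancelʳ-< 2 0 (f u) (<-trans 0<j j<2fu)) 0<fv d isDist

    broadcast-Packed : ∀ w → (∀ v → f v ≤ f w) → Packed n (λ x → f (w ⊕ x) * 2)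
    broadcast-Packed w maximal x x<n = fits , gap
      where
      gap : ∀ j → 0 < j → j < f (w ⊕ x) * 2 → f (w ⊕ (x + j)) * 2 ≡ 0
      gap j 0<j j<2f = cong (_* 2) (trans (cong f (sym (⊕-assoc w x j))) (broadcast-gap (w ⊕ x) 0<j j<2f))
      back-to-w : w ⊕ x ⊕ (n ∸ x) ≡ w
      back-to-w = begin
        w ⊕ x ⊕ (n ∸ x) ≡⟨ ⊕-assoc w x (n ∸ x) ⟩
        w ⊕ (x + (n ∸ x)) ≡⟨ cong (w ⊕_) (m+[n∸m]≡n (<⇒≤ x<n)) ⟩
        w ⊕ n             ≡⟨ ⊕-period w ⟩
        w                 ∎
        where open ≡-Reasoning
      -- A window running past n would contain w and silence it, but f w is maximal.
      silenced : n < x + f (w ⊕ x) * 2 → f (w ⊕ x) ≡ 0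
      silenced overflow = n≤0⇒n≡0 (subst (f (w ⊕ x) ≤_) fw≡0 (maximal (w ⊕ x)))
        where
        n∸x<2f : n ∸ x < f (w ⊕ x) * 2
        n∸x<2f = +-cancelˡ-< x (n ∸ x) _
                   (subst (_< x + f (w ⊕ x) * 2) (sym (m+[n∸m]≡n (<⇒≤ x<n))) overflow)
        fw≡0 : f w ≡ 0
        fw≡0 = trans (cong f (sym back-to-w)) (broadcast-gap (w ⊕ x) (m<n⇒0<n∸m x<n) n∸x<2f)
      fits : x + f (w ⊕ x) * 2 ≤ n
      fits = ≮⇒≥ λ overflow →
        <⇒≱ overflow (subst (λ y → x + y * 2 ≤ n) (sym (silenced overflow)) x+0≤n)
        where
        x+0≤n : x + 0 ≤ n
        x+0≤n = subst (_≤ n) (sym (+-identityʳ x)) (<⇒≤ x<n)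

    cost≤n/2 : cost G f ≤ n / 2
    cost≤n/2 = *2≤⇒≤/2 (begin
      cost G f * 2               ≡⟨ cong (_* 2) (cost≡∑ G f F (λ i → cong f (sym (mod-toℕ i)))) ⟩
      (∑[ x < n ] F x) * 2       ≡⟨ cong (_* 2) (∑-rotate F (toℕ w) periodic (<⇒≤ (toℕ<n w))) ⟨
      (∑[ x < n ] f (w ⊕ x)) * 2 ≡⟨ ∑-*ʳ n (λ x → f (w ⊕ x)) 2 ⟨
      ∑[ x < n ] f (w ⊕ x) * 2   ≤⟨ ∑≤-Packed n (broadcast-Packed w f≤fw) ⟩
      n                          ∎)
      where
      open ≤-Reasoning
      F : ℕ → ℕ
      F x = f (x mod n)
      periodic : ∀ x → F (n + x) ≡ F x
      periodic x = cong f (mod-cong (trans (cong (_% n) (+-comm n x)) ([m+n]%n≡m%n x n)))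
      w : Fin n
      w = proj₁ (maximum-attained f (0 mod n))
      f≤fw : ∀ v → f v ≤ f w
      f≤fw = proj₂ (maximum-attained f (0 mod n))

  dist-⊕2 : ∀ u → IsDist G u (u ⊕ 2) 2
  dist-⊕2 u = Jumps→walk u (jump₁ ∷ jump₁ ∷ []) , shorter
    where
    ⊕1≢ : ∀ v → v ⊕ 1 ≢ v
    ⊕1≢ v = ⊕-≢ v z<s (≤-trans (s≤s (s≤s z≤n)) 4≤n)
    ⊕2≢ : ∀ v → v ⊕ 2 ≢ v
    ⊕2≢ v = ⊕-≢ v z<s (≤-trans (s≤s (s≤s (s≤s z≤n))) 4≤n)
    shorter : ∀ k → k < 2 → ¬ Walk G k u (u ⊕ 2)
    shorter 0 _ w with walk→Jumps w
    ... | _ , [] , u⊕2≡u⊕0 = ⊕2≢ u (trans u⊕2≡u⊕0 (⊕-identityʳ u))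
    shorter 1 _ w with walk→Jumps w
    ... | _ , jump₁ ∷ [] , u⊕2≡u⊕1 = ⊕1≢ (u ⊕ 1) (trans (⊕-assoc u 1 1) u⊕2≡u⊕1)
    ... | _ , jump₃ ∷ [] , u⊕2≡u⊕3 = ⊕1≢ (u ⊕ 2) (trans (⊕-assoc u 2 1) (sym u⊕2≡u⊕3))
    shorter (suc (suc _)) (s≤s (s≤s ())) _

  2≤ecc : ∀ {v e} → IsEcc G v e → 2 ≤ e
  2≤ecc {v} ecc = proj₁ ecc (v ⊕ 2) 2 (dist-⊕2 v)

  2≤diam : ∀ {D} → IsDiam G D → 2 ≤ D
  2≤diam (_ , _ , ecc) = 2≤ecc ecc

  Quiet : (Fin n → ℕ) → Set
  Quiet f = ∀ u {k j} → suc k ≤ f u → Jumps (suc k) j → f (u ⊕ j) ≡ 0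

  IsIndepBroadcast-intro : ∀ {f} → (∀ v → f v ≤ 2) → Quiet f → IsIndepBroadcast G f
  IsIndepBroadcast-intro {f} f≤2 quiet =
      (λ D diam v → ≤-trans (f≤2 v) (2≤diam diam))
    , (λ v e ecc → ≤-trans (f≤2 v) (2≤ecc ecc))
    , independent
    where
    independent : ∀ u v → u ≢ v → 0 < f u → 0 < f v → ∀ d → IsDist G u v d → f u < d
    independent u v u≢v _ 0<fv d (w , _) with walk→Jumps w
    ... | _ , [] , v≡u⊕0 = ⊥-elim (u≢v (sym (trans v≡u⊕0 (⊕-identityʳ u))))
    ... | _ , jumps@(_ ∷ _) , refl = ≰⇒> λ d≤fu → <⇒≢ 0<fv (sym (quiet u d≤fu jumps))

  odd-indicator : Fin n → ℕ
  odd-indicator v = toℕ v % 2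

  odd-indicator≤2 : ∀ v → odd-indicator v ≤ 2
  odd-indicator≤2 v = m≤n⇒m≤1+n (s≤s⁻¹ (m%n<n (toℕ v) 2))

  module _ (m : ℕ) (n≡m*2 : n ≡ m * 2) where

    odd-indicator-quiet : Quiet odd-indicator
    odd-indicator-quiet u {zero} {j} 1≤fu jumps = begin
      toℕ (u ⊕ j) % 2     ≡⟨ cong (_% 2) (toℕ-mod (toℕ u + j)) ⟩
      (toℕ u + j) % n % 2 ≡⟨ m∣n⇒o%n%m≡o%m 2 n (toℕ u + j) (divides m n≡m*2) ⟩
      (toℕ u + j) % 2     ≡⟨ odd+odd (toℕ u) j u-odd (Jumps-1-odd jumps) ⟩
      0                   ∎
      where
      open ≡-Reasoning
      u-odd : toℕ u % 2 ≡ 1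
      u-odd = ≤-antisym (s≤s⁻¹ (m%n<n (toℕ u) 2)) 1≤fu
    odd-indicator-quiet u {suc k} 2+k≤fu _ =
      ⊥-elim (<⇒≱ (m%n<n (toℕ u) 2) (≤-trans (s≤s (s≤s z≤n)) 2+k≤fu))

    odd-indicator-cost : cost G odd-indicator ≡ m
    odd-indicator-cost = begin
      cost G odd-indicator ≡⟨ cost≡∑ G odd-indicator (_% 2) (λ _ → refl) ⟩
      ∑[ x < n ] x % 2     ≡⟨ cong (λ N → ∑[ x < N ] x % 2) n≡m*2 ⟩
      ∑[ x < m * 2 ] x % 2 ≡⟨ ∑-parity m ⟩
      m                    ∎
      where open ≡-Reasoning

  module _ (m : ℕ) (n≡1+m*2 : n ≡ suc (m * 2)) where

    even≢n : ∀ {y} → y % 2 ≡ 0 → y ≢ n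
    even≢n y-even refl =
      0≢1+n (trans (sym y-even) (trans (cong (_% 2) n≡1+m*2) ([m+kn]%n≡m%n 1 m 2)))

    5≤n : 5 ≤ n
    5≤n = ≤∧≢⇒< 4≤n (even≢n refl)

    <5⇒%n≡ : ∀ {y} → y < 5 → y % n ≡ y
    <5⇒%n≡ y<5 = m<n⇒m%n≡m (<-≤-trans y<5 5≤n)

    -- The broadcasters reach indices y ≤ n + 1 with y ≢ n (by parity), and n + 1 wraps to v₁.
    spike-odd-%n : ∀ {y} → y ≤ suc n → y ≢ n → spike-odd y ≡ 0 → spike-odd (y % n) ≡ 0
    spike-odd-%n y≤1+n y≢n spike-odd[y]≡0 with m≤n⇒m<n∨m≡n y≤1+n
    ... | inj₁ y<1+n =
      trans (cong spike-odd (m<n⇒m%n≡m (≤∧≢⇒< (s≤s⁻¹ y<1+n) y≢n))) spike-odd[y]≡0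
    ... | inj₂ refl  = cong spike-odd (trans ([m+n]%n≡m%n 1 n) (<5⇒%n≡ (s≤s (s≤s z≤n))))

    spike-odd-quiet-at : ∀ a {k j} → a < n → suc k ≤ spike-odd a → Jumps (suc k) j →
                         spike-odd ((a + j) % n) ≡ 0
    spike-odd-quiet-at 0 _ _ (jump₁ ∷ [])         = cong spike-odd (<5⇒%n≡ (from-yes (1 <? 5)))
    spike-odd-quiet-at 0 _ _ (jump₃ ∷ [])         = cong spike-odd (<5⇒%n≡ (from-yes (3 <? 5)))
    spike-odd-quiet-at 0 _ _ (jump₁ ∷ jump₁ ∷ []) = cong spike-odd (<5⇒%n≡ (from-yes (2 <? 5)))
    spike-odd-quiet-at 0 _ _ (jump₁ ∷ jump₃ ∷ []) = cong spike-odd (<5⇒%n≡ (from-yes (4 <? 5)))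
    spike-odd-quiet-at 0 _ _ (jump₃ ∷ jump₁ ∷ []) = cong spike-odd (<5⇒%n≡ (from-yes (4 <? 5)))
    spike-odd-quiet-at 0 _ _ (jump₃ ∷ jump₃ ∷ []) = spike-odd-%n (s≤s 5≤n) (even≢n refl) refl
    spike-odd-quiet-at 0 _ (s≤s (s≤s ())) (_ ∷ _ ∷ _ ∷ _)
    spike-odd-quiet-at 1 _ () _
    spike-odd-quiet-at 2 _ () _
    spike-odd-quiet-at 3 _ () _
    spike-odd-quiet-at 4 _ () _
    spike-odd-quiet-at a@(suc (suc (suc (suc (suc _))))) {zero} {j} a<n 1≤fa jumps =
      spike-odd-%n a+j≤1+n (even≢n a+j-even) a+j-even
      where
      a-odd : a % 2 ≡ 1
      a-odd = ≤-antisym (s≤s⁻¹ (m%n<n a 2)) 1≤fa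
      a+j-even : (a + j) % 2 ≡ 0
      a+j-even = odd+odd a j a-odd (Jumps-1-odd jumps)
      2+a≤n : 2 + a ≤ n
      2+a≤n = ≤∧≢⇒< a<n (even≢n (odd+odd 1 a refl a-odd))
      a+j≤1+n : a + j ≤ suc n
      a+j≤1+n = begin
        a + j ≤⟨ +-monoʳ-≤ a (Jumps-1-≤3 jumps) ⟩
        a + 3 ≡⟨ +-comm a 3 ⟩
        3 + a ≤⟨ s≤s 2+a≤n ⟩
        suc n ∎
        where open ≤-Reasoning
    spike-odd-quiet-at a@(suc (suc (suc (suc (suc _))))) {suc k} _ 2+k≤fa _ =
      ⊥-elim (<⇒≱ (m%n<n a 2) (≤-trans (s≤s (s≤s z≤n)) 2+k≤fa))

    spike-odd-quiet : Quiet (spike-odd ∘ toℕ)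
    spike-odd-quiet u {j = j} k<fu jumps =
      trans (cong spike-odd (toℕ-mod (toℕ u + j))) (spike-odd-quiet-at (toℕ u) (toℕ<n u) k<fu jumps)

    spike-odd-cost : cost G (spike-odd ∘ toℕ) ≡ m
    spike-odd-cost = begin
      cost G (spike-odd ∘ toℕ)         ≡⟨ cost≡∑ G (spike-odd ∘ toℕ) spike-odd (λ _ → refl) ⟩
      ∑[ x < n ] spike-odd x           ≡⟨ cong (λ N → ∑[ x < N ] spike-odd x) n≡1+m*2 ⟩
      ∑[ x < suc (m * 2) ] spike-odd x ≡⟨ ∑-spike-odd m (subst (4 ≤_) n≡1+m*2 4≤n) ⟩
      m                                ∎
      where open ≡-Reasoning

  βb≡n/2 : IsBroadcastIndepNumber G (n / 2)
  βb≡n/2 = optimal , λ f indep → cost≤n/2 indep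
    where
    optimal : Σ (Fin n → ℕ) λ f → IsIndepBroadcast G f × cost G f ≡ n / 2
    optimal with n % 2 | m≡m%n+[m/n]*n n 2 | m%n<n n 2
    ... | 0 | n≡[n/2]*2 | _ =
      odd-indicator
        , IsIndepBroadcast-intro odd-indicator≤2 (odd-indicator-quiet (n / 2) n≡[n/2]*2)
        , odd-indicator-cost (n / 2) n≡[n/2]*2
    ... | 1 | n≡1+[n/2]*2 | _ =
      spike-odd ∘ toℕ
        , IsIndepBroadcast-intro (spike-odd≤2 ∘ toℕ) (spike-odd-quiet (n / 2) n≡1+[n/2]*2)
        , spike-odd-cost (n / 2) n≡1+[n/2]*2
    ... | suc (suc _) | _ | s≤s (s≤s ())

theorem7 : (n : ℕ) → 4 ≤ n →
    IsBroadcastIndepNumber (Circulant n (+ 1 ∷ + 3 ∷ [])) (n / 2)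
    × IsBroadcastIndepNumber (Circulant n (+ 1 ∷ - (+ (n ∸ 3)) ∷ [])) (n / 2)
theorem7 n 4≤n =
    OneThreeCirculant.βb≡n/2 4≤n (Circulant n (+ 1 ∷ + 3 ∷ [])) C[1,3]-arc⇔Step
  , OneThreeCirculant.βb≡n/2 4≤n (Circulant n (+ 1 ∷ - (+ (n ∸ 3)) ∷ []))
                              (C[1,3-n]-arc⇔Step 3≤n)
  where
  instance
    nonZero : NonZero n
    nonZero = >-nonZero (≤-trans (s≤s z≤n) 4≤n)
  3≤n : 3 ≤ n
  3≤n = ≤-trans (n≤1+n 3) 4≤n
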